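{- For all positive integers $m$ and $d$, \[ \mathsf{s}_{2m}(\mathbb{Z}_2^d) = 1 + \max_{1 \leq j \leq m} \left\{ \beta_{\{2j, 2j+2, \ldots, 2m\}}(d) + (2m-2j) \right\}. \]
   Context: $\mathsf{s}_{2m}(\mathbb{Z}_2^d)$ denotes the smallest integer $s$ such that every sequence (repetitions allowed) of length $s$ of elements of $\mathbb{Z}_2^d$ has a subsequence of length $2m$ whose elements sum to $0$. For a set $W$ of positive integers containing at least one even number, $\beta_W(d)$ denotes the largest size of a set $A \subseteq \mathbb{Z}_2^d$ (of distinct elements) which has no subset $B \subseteq A$ with $|B| \in W$ and $\sum_{x\in B} x = 0$. -}

module Defs where

open import Data.Nat using (ℕ; zero; suc; _+_; _*_; _∸_; _≤_; _⊔_)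
open import Data.Bool using (Bool; true; false; _xor_)
open import Data.Vec using (Vec; []; _∷_; replicate; zipWith)
open import Data.Fin using (Fin)
open import Data.Fin.Subset using (Subset; ∣_∣)
open import Data.Product using (Σ; _×_)
open import Function.Definitions using (Injective)
open import Relation.Binary.PropositionalEquality using (_≡_)
open import Relation.Nullary using (¬_)

Z2^ : ℕ → Set
Z2^ d = Vec Bool d

0ᴳ : ∀ {d} → Z2^ d
0ᴳ = replicate _ false

_⊕_ : ∀ {d} → Z2^ d → Z2^ d → Z2^ d
_⊕_ = zipWith _xor_

sumSub : ∀ {d s} → (Fin s → Z2^ d) → Subset s → Z2^ d
sumSub {s = zero}  x []      = 0ᴳ
sumSub {s = suc s} x (b ∷ S) with b
... | true  = x Fin.zero ⊕ sumSub (λ i → x (Fin.suc i)) S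
... | false = sumSub (λ i → x (Fin.suc i)) S

HasZeroSumSub : ∀ {d s} → ℕ → (Fin s → Z2^ d) → Set
HasZeroSumSub {s = s} n x = Σ (Subset s) λ S → ∣ S ∣ ≡ n × sumSub x S ≡ 0ᴳ

EveryHas : ℕ → ℕ → ℕ → Set
EveryHas n d s = (x : Fin s → Z2^ d) → HasZeroSumSub n x

IsOlson : ℕ → ℕ → ℕ → Set
IsOlson n d s = EveryHas n d s × (∀ t → EveryHas n d t → s ≤ t)

WFree : (ℕ → Set) → ∀ {d k} → (Fin k → Z2^ d) → Set
WFree W {k = k} a = Injective _≡_ _≡_ a ×
  ((B : Subset k) → W ∣ B ∣ → ¬ (sumSub a B ≡ 0ᴳ))

IsBeta : (ℕ → Set) → ℕ → ℕ → Set
IsBeta W d b = Σ (Fin b → Z2^ d) (WFree W)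
             × (∀ k (a : Fin k → Z2^ d) → WFree W a → k ≤ b)

EvenRange : ℕ → ℕ → ℕ → Set
EvenRange j m n = Σ ℕ λ i → n ≡ 2 * i × j ≤ i × i ≤ m

-- max_{1 ≤ j ≤ k} f j  (for k ≥ 1; maxFrom1 0 f = 0 is unused)
maxFrom1 : ℕ → (ℕ → ℕ) → ℕ
maxFrom1 zero f = 0
maxFrom1 (suc zero) f = f 1
maxFrom1 (suc (suc k)) f = f (suc (suc k)) ⊔ maxFrom1 (suc k) f

module Submission where

-- By induction on the length s we show: if
-- j + p = m and s + 2p > M, then every sequence of length s has a zero-sum
-- subsequence whose size lies in W_j.  For j = 0 the empty subsequence works.
-- Otherwise, if the terms are distinct they form a set of more than β_{W_j}(d)
-- elements, which therefore is not W_j-free; if two terms are equal, delete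
-- them, apply the induction hypothesis for (j − 1, p + 1) and put the pair back
-- whenever this keeps the size at most 2m.  With j = m, p = 0 this says that
-- every sequence of length M + 1 has a zero-sum subsequence of length 2m.
--
-- If A is a W_j-free set of β_{W_j}(d) ≥ 1
-- elements and a ∈ A, then A followed by 2m − 2j more copies of a has no
-- zero-sum subsequence of length 2m: such a subsequence uses the extra copies an
-- even number of times (then its part in A is a zero-sum subset with size in
-- W_j) or an odd number of times (then toggling a in its part in A gives one).

open import Defs
open import Data.Nat using (ℕ; zero; suc; _+_; _*_; _∸_; _≤_; _<_; z≤n; s≤s; _≤?_)
open import Data.Nat.Properties
open import Data.Nat.Tactic.RingSolver using (solve-∀)
open import Data.Bool using (Bool; true; false)
import Data.Bool.Properties as Bool
open import Data.Vec using ([]; _∷_; insertAt; _++_)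
import Data.Vec as Vec
open import Data.Vec.Properties using (zipWith-assoc; zipWith-comm; zipWith-identityˡ; zipWith-identityʳ; ≡-dec)
import Data.Vec.Functional as Seq
open import Data.Fin using (Fin; punchIn; toℕ; fromℕ<; splitAt)
open import Data.Fin.Properties using (any?; toℕ-fromℕ<)
open import Data.Fin.Subset using (Subset; ∣_∣; ⊥)
open import Data.Fin.Subset.Properties using (∣p∣≤n; ∣⊥∣≡0; anySubset?)
open import Data.Product using (Σ; ∃; _×_; _,_; proj₂)
open import Data.Sum using (_⊎_; inj₁; inj₂)
open import Function.Definitions using (Injective)
open import Relation.Nullary using (¬_; Dec; yes; no; contradiction)
open import Relation.Nullary.Decidable using (map′; _×-dec_)
open import Relation.Unary using (Decidable)
open import Relation.Binary.PropositionalEquality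

⊕-assoc : ∀ {d} (x y z : Z2^ d) → (x ⊕ y) ⊕ z ≡ x ⊕ (y ⊕ z)
⊕-assoc = zipWith-assoc Bool.xor-assoc

⊕-comm : ∀ {d} (x y : Z2^ d) → x ⊕ y ≡ y ⊕ x
⊕-comm = zipWith-comm Bool.xor-comm

⊕-identityˡ : ∀ {d} (x : Z2^ d) → 0ᴳ ⊕ x ≡ x
⊕-identityˡ = zipWith-identityˡ Bool.xor-identityˡ

⊕-identityʳ : ∀ {d} (x : Z2^ d) → x ⊕ 0ᴳ ≡ x
⊕-identityʳ = zipWith-identityʳ Bool.xor-identityʳ

⊕-self : ∀ {d} (x : Z2^ d) → x ⊕ x ≡ 0ᴳ
⊕-self []      = refl
⊕-self (a ∷ x) = cong₂ _∷_ (Bool.xor-same a) (⊕-self x)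

⊕-involutive : ∀ {d} (x y : Z2^ d) → x ⊕ (x ⊕ y) ≡ y
⊕-involutive x y = begin
  x ⊕ (x ⊕ y)  ≡⟨ ⊕-assoc x x y ⟨
  (x ⊕ x) ⊕ y  ≡⟨ cong (_⊕ y) (⊕-self x) ⟩
  0ᴳ ⊕ y       ≡⟨ ⊕-identityˡ y ⟩
  y            ∎
  where open ≡-Reasoning

⊕≡0⇒≡ : ∀ {d} (x y : Z2^ d) → x ⊕ y ≡ 0ᴳ → x ≡ y
⊕≡0⇒≡ x y x⊕y≡0 = begin
  x             ≡⟨ ⊕-identityʳ x ⟨
  x ⊕ 0ᴳ        ≡⟨ cong (x ⊕_) x⊕y≡0 ⟨
  x ⊕ (x ⊕ y)   ≡⟨ ⊕-involutive x y ⟩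
  y             ∎
  where open ≡-Reasoning

_≟ᴳ_ : ∀ {d} (x y : Z2^ d) → Dec (x ≡ y)
_≟ᴳ_ = ≡-dec Bool._≟_

sumSub-cong : ∀ {d s} {x y : Fin s → Z2^ d} → (∀ i → x i ≡ y i) → (S : Subset s) →
  sumSub x S ≡ sumSub y S
sumSub-cong x≗y []          = refl
sumSub-cong x≗y (true ∷ S)  = cong₂ _⊕_ (x≗y Fin.zero) (sumSub-cong (λ i → x≗y (Fin.suc i)) S)
sumSub-cong x≗y (false ∷ S) = sumSub-cong (λ i → x≗y (Fin.suc i)) S

sumSub-⊥ : ∀ {d s} (x : Fin s → Z2^ d) → sumSub x ⊥ ≡ 0ᴳ
sumSub-⊥ {s = zero}  x = refl
sumSub-⊥ {s = suc s} x = sumSub-⊥ (λ i → x (Fin.suc i))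

sumSub-insert-true : ∀ {d s} (x : Fin (suc s) → Z2^ d) i (S : Subset s) →
  sumSub x (insertAt S i true) ≡ x i ⊕ sumSub (λ t → x (punchIn i t)) S
sumSub-insert-true x Fin.zero    S           = refl
sumSub-insert-true x (Fin.suc i) (false ∷ S) = sumSub-insert-true (λ t → x (Fin.suc t)) i S
sumSub-insert-true x (Fin.suc i) (true ∷ S)  = begin
  x₀ ⊕ sumSub x⁺ (insertAt S i true)  ≡⟨ cong (x₀ ⊕_) (sumSub-insert-true x⁺ i S) ⟩
  x₀ ⊕ (x⁺ i ⊕ rest)                  ≡⟨ ⊕-assoc x₀ (x⁺ i) rest ⟨
  (x₀ ⊕ x⁺ i) ⊕ rest                  ≡⟨ cong (_⊕ rest) (⊕-comm x₀ (x⁺ i)) ⟩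
  (x⁺ i ⊕ x₀) ⊕ rest                  ≡⟨ ⊕-assoc (x⁺ i) x₀ rest ⟩
  x⁺ i ⊕ (x₀ ⊕ rest)                  ∎
  where
  open ≡-Reasoning
  x₀   = x Fin.zero
  x⁺   = λ t → x (Fin.suc t)
  rest = sumSub (λ t → x⁺ (punchIn i t)) S

sumSub-insert-false : ∀ {d s} (x : Fin (suc s) → Z2^ d) i (S : Subset s) →
  sumSub x (insertAt S i false) ≡ sumSub (λ t → x (punchIn i t)) S
sumSub-insert-false x Fin.zero    S           = refl
sumSub-insert-false x (Fin.suc i) (true ∷ S)  =
  cong (x Fin.zero ⊕_) (sumSub-insert-false (λ t → x (Fin.suc t)) i S)
sumSub-insert-false x (Fin.suc i) (false ∷ S) = sumSub-insert-false (λ t → x (Fin.suc t)) i S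

card-insert-true : ∀ {s} i (S : Subset s) → ∣ insertAt S i true ∣ ≡ suc ∣ S ∣
card-insert-true Fin.zero    S           = refl
card-insert-true (Fin.suc i) (true ∷ S)  = cong suc (card-insert-true i S)
card-insert-true (Fin.suc i) (false ∷ S) = card-insert-true i S

card-insert-false : ∀ {s} i (S : Subset s) → ∣ insertAt S i false ∣ ≡ ∣ S ∣
card-insert-false Fin.zero    S           = refl
card-insert-false (Fin.suc i) (true ∷ S)  = cong suc (card-insert-false i S)
card-insert-false (Fin.suc i) (false ∷ S) = card-insert-false i S

++-tail : ∀ {A : Set} {n r} (x : Fin (suc n) → A) (y : Fin r → A) (i : Fin (n + r)) →
  (x Seq.++ y) (Fin.suc i) ≡ ((λ t → x (Fin.suc t)) Seq.++ y) i
++-tail {n = n} x y i with splitAt n i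
... | inj₁ _ = refl
... | inj₂ _ = refl

sumSub-++ : ∀ {d n r} (x : Fin n → Z2^ d) (y : Fin r → Z2^ d) (S₁ : Subset n) (S₂ : Subset r) →
  sumSub (x Seq.++ y) (S₁ ++ S₂) ≡ sumSub x S₁ ⊕ sumSub y S₂
sumSub-++ x y []          S₂ = sym (⊕-identityˡ _)
sumSub-++ x y (false ∷ S₁) S₂ = trans (sumSub-cong (++-tail x y) (S₁ ++ S₂)) (sumSub-++ _ y S₁ S₂)
sumSub-++ x y (true ∷ S₁)  S₂ =
  trans (cong (x Fin.zero ⊕_) (trans (sumSub-cong (++-tail x y) (S₁ ++ S₂)) (sumSub-++ _ y S₁ S₂)))
        (sym (⊕-assoc _ _ _))

card-++ : ∀ {n r} (S₁ : Subset n) (S₂ : Subset r) → ∣ S₁ ++ S₂ ∣ ≡ ∣ S₁ ∣ + ∣ S₂ ∣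
card-++ []           S₂ = refl
card-++ (true ∷ S₁)  S₂ = cong suc (card-++ S₁ S₂)
card-++ (false ∷ S₁) S₂ = card-++ S₁ S₂

constant-sum-parity : ∀ {d r} (a : Z2^ d) (S : Subset r) → ∃ λ q →
  (∣ S ∣ ≡ 2 * q × sumSub (λ _ → a) S ≡ 0ᴳ) ⊎ (∣ S ∣ ≡ suc (2 * q) × sumSub (λ _ → a) S ≡ a)
constant-sum-parity a []          = 0 , inj₁ (refl , refl)
constant-sum-parity a (false ∷ S) = constant-sum-parity a S
constant-sum-parity a (true ∷ S) with constant-sum-parity a S
... | q , inj₁ (even , sum≡0) = q , inj₂ (cong suc even , trans (cong (a ⊕_) sum≡0) (⊕-identityʳ a))
... | q , inj₂ (odd , sum≡a)  = suc q , inj₁ (trans (cong suc odd) (sym (*-suc 2 q)) ,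
                                              trans (cong (a ⊕_) sum≡a) (⊕-self a))

HasWZeroSum : ∀ {d s} → (ℕ → Set) → (Fin s → Z2^ d) → Set
HasWZeroSum {s = s} W x = Σ (Subset s) λ B → W ∣ B ∣ × sumSub x B ≡ 0ᴳ

-- Having a zero-sum subsequence of length n persists for longer sequences:
-- ignore the extra terms at the front.
everyHas-mono : ∀ {n d t t'} → t ≤ t' → EveryHas n d t → EveryHas n d t'
everyHas-mono {n} {d} {t} {t'} t≤t' H = subst (EveryHas n d) (m∸n+n≡m t≤t') (prepend (t' ∸ t))
  where
  prepend : ∀ k → EveryHas n d (k + t)
  prepend zero    = H
  prepend (suc k) x with prepend k (λ i → x (Fin.suc i))
  ... | S , size , sum = false ∷ S , size , sum

evenRange? : ∀ j m → Decidable (EvenRange j m)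
evenRange? j m n = map′ fromFin toFin
  (any? λ (i : Fin (suc m)) → (n ≟ 2 * toℕ i) ×-dec (j ≤? toℕ i) ×-dec (toℕ i ≤? m))
  where
  fromFin : ∃ (λ (i : Fin (suc m)) → n ≡ 2 * toℕ i × j ≤ toℕ i × toℕ i ≤ m) → EvenRange j m n
  fromFin (i , facts) = toℕ i , facts
  toFin : EvenRange j m n → ∃ (λ (i : Fin (suc m)) → n ≡ 2 * toℕ i × j ≤ toℕ i × toℕ i ≤ m)
  toFin (i , facts@(_ , _ , i≤m)) = fromℕ< (s≤s i≤m) ,
    subst (λ t → n ≡ 2 * t × j ≤ t × t ≤ m) (sym (toℕ-fromℕ< (s≤s i≤m))) facts

evenRange-≥2 : ∀ {j m n} → 1 ≤ j → EvenRange j m n → 2 ≤ n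
evenRange-≥2 1≤j (i , refl , j≤i , _) = *-monoʳ-≤ 2 (≤-trans 1≤j j≤i)

evenRange-top : ∀ {m n} → EvenRange m m n → n ≡ 2 * m
evenRange-top (i , n≡2i , m≤i , i≤m) = trans n≡2i (cong (2 *_) (≤-antisym i≤m m≤i))

-- A size in W_j can be moved into W_{j+1}: add 2 if that stays ≤ 2m, else it already is 2m.
evenRange-step : ∀ {j m n} → suc j ≤ m → EvenRange j m n →
  EvenRange (suc j) m (2 + n) ⊎ EvenRange (suc j) m n
evenRange-step j<m (i , refl , j≤i , i≤m) with m≤n⇒m<n∨m≡n i≤m
... | inj₁ i<m  = inj₁ (suc i , sym (*-suc 2 i) , s≤s j≤i , i<m)
... | inj₂ refl = inj₂ (i , refl , j<m , ≤-refl)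

evenRange-gap : ∀ {c q j e} → c + 2 * q ≡ 2 * (j + e) → q ≤ e → EvenRange j (j + e) c
evenRange-gap {c} {q} {j} c+2q≡ q≤e with m≤n⇒∃[o]m+o≡n q≤e
... | f , refl = j + f , +-cancelʳ-≡ (2 * q) c (2 * (j + f)) (trans c+2q≡ (regroup j q f)) ,
                 m≤m+n j f , +-monoʳ-≤ j (m≤n+m f q)
  where
  regroup : ∀ j q f → 2 * (j + (q + f)) ≡ 2 * (j + f) + 2 * q
  regroup = solve-∀

double-gap : ∀ {j p m} → j + p ≡ m → 2 * m ∸ 2 * j ≡ 2 * p
double-gap {j} {p} refl = trans (cong (_∸ 2 * j) (*-distribˡ-+ 2 j p)) (m+n∸m≡n (2 * j) (2 * p))

-- A sequence of more than β_W(d) distinct terms is not W-free; since W-freeness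
-- is decidable, it has an explicit zero-sum subsequence with size in W.
large-set-has-zero-sum : ∀ {W d b s} → Decidable W → IsBeta W d b → b < s →
  (y : Fin s → Z2^ d) → Injective _≡_ _≡_ y → HasWZeroSum W y
large-set-has-zero-sum W? (_ , maximal) b<s y inj
  with anySubset? (λ B → W? ∣ B ∣ ×-dec (sumSub y B ≟ᴳ 0ᴳ))
... | yes witness = witness
... | no none     = contradiction (maximal _ y (inj , λ B w z → none (B , w , z))) (<⇒≱ b<s)

-- {0ᴳ} is W-free, so β_W(d) ≥ 1.
beta-positive : ∀ {W d b} → (∀ n → W n → 2 ≤ n) → IsBeta W d b → 1 ≤ b
beta-positive large (_ , maximal) = maximal 1 (λ _ → 0ᴳ)
  ((λ { {Fin.zero} {Fin.zero} _ → refl }) , λ B w _ → ≤⇒≯ (∣p∣≤n B) (large _ w))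

Duplicate : ∀ {d s} → (Fin (suc s) → Z2^ d) → Set
Duplicate {s = s} y = Σ (Fin (suc s)) λ i → Σ (Fin s) λ k → y i ≡ y (punchIn i k)

duplicate-or-injective : ∀ {d s} (y : Fin (suc s) → Z2^ d) → Duplicate y ⊎ Injective _≡_ _≡_ y
duplicate-or-injective {s = zero} y = inj₂ λ { {Fin.zero} {Fin.zero} _ → refl }
duplicate-or-injective {s = suc s} y with any? (λ k → y Fin.zero ≟ᴳ y (Fin.suc k))
... | yes (k , e) = inj₁ (Fin.zero , k , e)
... | no head-new with duplicate-or-injective (λ i → y (Fin.suc i))
...   | inj₁ (i , k , e) = inj₁ (Fin.suc i , Fin.suc k , e)
...   | inj₂ tail-inj    = inj₂ injective
  where
  injective : Injective _≡_ _≡_ y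
  injective {Fin.zero}  {Fin.zero}  _ = refl
  injective {Fin.zero}  {Fin.suc j} e = contradiction (j , e) head-new
  injective {Fin.suc i} {Fin.zero}  e = contradiction (i , sym e) head-new
  injective {Fin.suc i} {Fin.suc j} e = cong Fin.suc (tail-inj e)

removePair : ∀ {d s} → (Fin (suc (suc s)) → Z2^ d) → Fin (suc (suc s)) → Fin (suc s) → Fin s → Z2^ d
removePair y i k t = y (punchIn i (punchIn k t))

restore : ∀ {s} → Fin (suc (suc s)) → Fin (suc s) → Bool → Subset s → Subset (suc (suc s))
restore i k b B = insertAt (insertAt B k b) i b

sumSub-restore-false : ∀ {d s} (y : Fin (suc (suc s)) → Z2^ d) i k (B : Subset s) →
  sumSub y (restore i k false B) ≡ sumSub (removePair y i k) B
sumSub-restore-false y i k B =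
  trans (sumSub-insert-false y i _) (sumSub-insert-false (λ t → y (punchIn i t)) k B)

sumSub-restore-true : ∀ {d s} (y : Fin (suc (suc s)) → Z2^ d) i k (B : Subset s) →
  y i ≡ y (punchIn i k) → sumSub y (restore i k true B) ≡ sumSub (removePair y i k) B
sumSub-restore-true y i k B same = begin
  sumSub y (restore i k true B)
    ≡⟨ sumSub-insert-true y i _ ⟩
  y i ⊕ sumSub (λ t → y (punchIn i t)) (insertAt B k true)
    ≡⟨ cong (y i ⊕_) (sumSub-insert-true (λ t → y (punchIn i t)) k B) ⟩
  y i ⊕ (y (punchIn i k) ⊕ sumSub (removePair y i k) B)
    ≡⟨ cong (λ z → y i ⊕ (z ⊕ sumSub (removePair y i k) B)) same ⟨
  y i ⊕ (y i ⊕ sumSub (removePair y i k) B)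
    ≡⟨ ⊕-involutive (y i) _ ⟩
  sumSub (removePair y i k) B ∎
  where open ≡-Reasoning

card-restore-false : ∀ {s} i k (B : Subset s) → ∣ restore i k false B ∣ ≡ ∣ B ∣
card-restore-false i k B = trans (card-insert-false i _) (card-insert-false k B)

card-restore-true : ∀ {s} i k (B : Subset s) → ∣ restore i k true B ∣ ≡ 2 + ∣ B ∣
card-restore-true i k B = trans (card-insert-true i _) (cong suc (card-insert-true k B))

lift-zero-sum : ∀ {d s j m} (y : Fin (suc (suc s)) → Z2^ d) i k → suc j ≤ m →
  y i ≡ y (punchIn i k) → HasWZeroSum (EvenRange j m) (removePair y i k) →
  HasWZeroSum (EvenRange (suc j) m) y
lift-zero-sum {j = j} {m} y i k j<m same (B , w , z) with evenRange-step j<m w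
... | inj₁ w⁺ = restore i k true B ,
                subst (EvenRange (suc j) m) (sym (card-restore-true i k B)) w⁺ ,
                trans (sumSub-restore-true y i k B same) z
... | inj₂ w⁺ = restore i k false B ,
                subst (EvenRange (suc j) m) (sym (card-restore-false i k B)) w⁺ ,
                trans (sumSub-restore-false y i k B) z

module UpperBound {d m M : ℕ} (β : ℕ → ℕ)
  (β-isβ : ∀ j → 1 ≤ j → j ≤ m → IsBeta (EvenRange j m) d (β j))
  (β-bound : ∀ j p → 1 ≤ j → j + p ≡ m → β j + 2 * p ≤ M) where

  distinct-case : ∀ {s} j p → suc j + p ≡ m → M < s + 2 * p →
    (y : Fin s → Z2^ d) → Injective _≡_ _≡_ y → HasWZeroSum (EvenRange (suc j) m) y
  distinct-case {s} j p jp M< = large-set-has-zero-sum (evenRange? (suc j) m)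
    (β-isβ (suc j) (s≤s z≤n) (subst (suc j ≤_) jp (m≤m+n (suc j) p)))
    (+-cancelʳ-< (2 * p) (β (suc j)) s (≤-<-trans (β-bound (suc j) p (s≤s z≤n) jp) M<))

  zero-sum-in-range : ∀ s (y : Fin s → Z2^ d) j p → j + p ≡ m → M < s + 2 * p →
    HasWZeroSum (EvenRange j m) y
  zero-sum-in-range s y zero p _ _ = ⊥ , (0 , ∣⊥∣≡0 s , z≤n , z≤n) , sumSub-⊥ y
  zero-sum-in-range zero y (suc j) p jp M< = distinct-case j p jp M< y λ { {()} }
  zero-sum-in-range (suc zero) y (suc j) p jp M< =
    distinct-case j p jp M< y λ { {Fin.zero} {Fin.zero} _ → refl }
  zero-sum-in-range (suc (suc s)) y (suc j) p jp M< with duplicate-or-injective y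
  ... | inj₂ inj         = distinct-case j p jp M< y inj
  ... | inj₁ (i , k , e) = lift-zero-sum y i k (subst (suc j ≤_) jp (m≤m+n (suc j) p)) e
    (zero-sum-in-range s (removePair y i k) j (suc p) (trans (+-suc j p) jp)
      (subst (M <_) (move-pair s p) M<))
    where
    move-pair : ∀ s p → suc (suc s) + 2 * p ≡ s + 2 * suc p
    move-pair = solve-∀

  long-sequences-have-zero-sums : EveryHas (2 * m) d (suc M)
  long-sequences-have-zero-sums x with zero-sum-in-range (suc M) x m 0 (+-identityʳ m) (m≤m+n (suc M) 0)
  ... | B , w , z = B , evenRange-top w , z

module LowerBound {d j e b : ℕ} (A : Fin (suc b) → Z2^ d) (free : WFree (EvenRange j (j + e)) A) where

  a : Z2^ d
  a = A Fin.zero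

  padded : Fin (suc b + 2 * e) → Z2^ d
  padded = A Seq.++ (λ _ → a)

  -- If the part of the subsequence in A has sum a and odd size 2m − (2q + 1),
  -- toggling a in it gives a zero-sum subset with size in W_j.
  toggle : ∀ q (S₁ : Subset (suc b)) → ∣ S₁ ∣ + suc (2 * q) ≡ 2 * (j + e) → q < e →
    sumSub A S₁ ≡ a → HasWZeroSum (EvenRange j (j + e)) A
  toggle q (true ∷ T) size q<e sum≡a =
    false ∷ T , evenRange-gap (trans (two-ones ∣ T ∣ q) size) q<e ,
    (begin
      sumSub (λ i → A (Fin.suc i)) T            ≡⟨ ⊕-involutive a _ ⟨
      a ⊕ (a ⊕ sumSub (λ i → A (Fin.suc i)) T)  ≡⟨ cong (a ⊕_) sum≡a ⟩
      a ⊕ a                                     ≡⟨ ⊕-self a ⟩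
      0ᴳ                                        ∎)
    where
    open ≡-Reasoning
    two-ones : ∀ c q → c + 2 * suc q ≡ suc c + suc (2 * q)
    two-ones = solve-∀
  toggle q (false ∷ T) size q<e sum≡a =
    true ∷ T , evenRange-gap (trans (sym (+-suc ∣ T ∣ (2 * q))) size) (<⇒≤ q<e) ,
    trans (cong (a ⊕_) sum≡a) (⊕-self a)

  from-split : (S₁ : Subset (suc b)) (S₂ : Subset (2 * e)) → ∣ S₁ ∣ + ∣ S₂ ∣ ≡ 2 * (j + e) →
    sumSub A S₁ ⊕ sumSub (λ _ → a) S₂ ≡ 0ᴳ → HasWZeroSum (EvenRange j (j + e)) A
  from-split S₁ S₂ size sum with constant-sum-parity a S₂
  ... | q , inj₁ (even , copies≡0) =
    S₁ , evenRange-gap {∣ S₁ ∣} {q} {j} {e} (subst (λ c → ∣ S₁ ∣ + c ≡ 2 * (j + e)) even size)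
                       (*-cancelˡ-≤ 2 (subst (_≤ 2 * e) even (∣p∣≤n S₂))) ,
    trans (sym (⊕-identityʳ _)) (trans (cong (sumSub A S₁ ⊕_) (sym copies≡0)) sum)
  ... | q , inj₂ (odd , copies≡a) =
    toggle q S₁ (subst (λ c → ∣ S₁ ∣ + c ≡ 2 * (j + e)) odd size)
      (*-cancelˡ-< 2 q e (subst (_≤ 2 * e) odd (∣p∣≤n S₂)))
      (⊕≡0⇒≡ _ a (trans (cong (sumSub A S₁ ⊕_) (sym copies≡a)) sum))

  no-zero-sum : ¬ HasZeroSumSub (2 * (j + e)) padded
  no-zero-sum (S , size , sum) with Vec.splitAt (suc b) S
  ... | S₁ , S₂ , refl with from-split S₁ S₂ (trans (sym (card-++ S₁ S₂)) size)
                                             (trans (sym (sumSub-++ A (λ _ → a) S₁ S₂)) sum)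
  ...   | B , w , z = proj₂ free B w z

short-sequence-without-zero-sum : ∀ {d m b} j → 1 ≤ j → j ≤ m → IsBeta (EvenRange j m) d b →
  ¬ EveryHas (2 * m) d (b + (2 * m ∸ 2 * j))
short-sequence-without-zero-sum j 1≤j j≤m isβ with m≤n⇒∃[o]m+o≡n j≤m
short-sequence-without-zero-sum {b = zero} j 1≤j _ isβ | _ =
  contradiction (beta-positive (λ _ → evenRange-≥2 1≤j) isβ) λ ()
short-sequence-without-zero-sum {d} {b = suc b} j _ _ ((A , free) , _) | e , refl = λ H →
  no-zero-sum (subst (EveryHas (2 * (j + e)) d) (cong (suc b +_) (double-gap {j} {e} refl)) H padded)
  where open LowerBound A free

maxFrom1-upper : ∀ k f j → 1 ≤ j → j ≤ k → f j ≤ maxFrom1 k f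
maxFrom1-upper zero          f (suc j)       _   ()
maxFrom1-upper (suc zero)    f (suc zero)    _   _   = ≤-refl
maxFrom1-upper (suc zero)    f (suc (suc j)) _   (s≤s ())
maxFrom1-upper (suc (suc k)) f j             1≤j j≤k =
  last-or-earlier (m≤n⇒m<n∨m≡n j≤k) (maxFrom1-upper (suc k) f j 1≤j)
  where
  last-or-earlier : j < suc (suc k) ⊎ j ≡ suc (suc k) →
    (j ≤ suc k → f j ≤ maxFrom1 (suc k) f) → f j ≤ maxFrom1 (suc (suc k)) f
  last-or-earlier (inj₁ (s≤s j≤k')) earlier = ≤-trans (earlier j≤k') (m≤n⊔m _ _)
  last-or-earlier (inj₂ refl)       _       = m≤m⊔n _ _

maxFrom1-attained : ∀ k f → 1 ≤ k → ∃ λ j → 1 ≤ j × j ≤ k × maxFrom1 k f ≡ f j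
maxFrom1-attained (suc zero)    f _ = 1 , ≤-refl , ≤-refl , refl
maxFrom1-attained (suc (suc k)) f _ with maxFrom1-attained (suc k) f (s≤s z≤n)
... | j , 1≤j , j≤k , e with ⊔-sel (f (suc (suc k))) (maxFrom1 (suc k) f)
...   | inj₁ top  = suc (suc k) , s≤s z≤n , ≤-refl , top
...   | inj₂ rest = j , 1≤j , m≤n⇒m≤1+n j≤k , trans rest e

theorem6 : (m d : ℕ) → 1 ≤ m → 1 ≤ d →
    (β : ℕ → ℕ) → (∀ j → 1 ≤ j → j ≤ m → IsBeta (EvenRange j m) d (β j)) →
    IsOlson (2 * m) d (1 + maxFrom1 m (λ j → β j + (2 * m ∸ 2 * j)))
theorem6 m d 1≤m _ β isβ = long-sequences-have-zero-sums , minimal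
  where
  f : ℕ → ℕ
  f j = β j + (2 * m ∸ 2 * j)

  M : ℕ
  M = maxFrom1 m f

  β-bound : ∀ j p → 1 ≤ j → j + p ≡ m → β j + 2 * p ≤ M
  β-bound j p 1≤j jp = subst (λ g → β j + g ≤ M) (double-gap {j} {p} jp)
    (maxFrom1-upper m f j 1≤j (subst (j ≤_) jp (m≤m+n j p)))

  open UpperBound β isβ β-bound

  minimal : ∀ t → EveryHas (2 * m) d t → 1 + M ≤ t
  minimal t H with maxFrom1-attained m f 1≤m
  ... | j , 1≤j , j≤m , M≡fj = ≮⇒≥ λ { (s≤s t≤M) →
    short-sequence-without-zero-sum j 1≤j j≤m (isβ j 1≤j j≤m)
      (subst (EveryHas (2 * m) d) M≡fj (everyHas-mono t≤M H)) }
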